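{- Let $P$ be a program (built from assignments, if-then-else and sequential composition, as described in the context) whose variables are $x_1,\ldots,x_n$, and let $[P]$ be its translation into FOOL with tuples, defined with respect to the tuple $(x_1,\ldots,x_n)$. Let $u_1,\ldots,u_n,v_1,\ldots,v_n$ be values, where $u_i$ and $v_i$ are of the same type as $x_i$ for each $i$. If executing $P$ changes the state $\{x_1\to u_1,\ldots,x_n\to u_n\}$ to the state $\{x_1\to v_1,\ldots,x_n\to v_n\}$, then the value of the expression $[P]$ in the state $\{x_1\to u_1,\ldots,x_n\to u_n\}$ is the tuple $(v_1,\ldots,v_n)$.
   Context: Programs. Fix typed program variables $x_1,\ldots,x_n$ and a first-order signature with a fixed interpretation (e.g. integer arithmetic). A program is generated by the grammar: an assignment $x_i := e$, where $e$ is a term over the signature whose free variables are among $x_1,\ldots,x_n$ and whose type is that of $x_i$; a conditional $\textbf{if } e \textbf{ then } P_1 \textbf{ else } P_2$, where $e$ is a boolean term (formula) over $x_1,\ldots,x_n$ and $P_1,P_2$ are programs; and a sequential composition $P_1 ; P_2$. A state is an assignment of values to $x_1,\ldots,x_n$; programs have the standard deterministic semantics (an assignment updates the one variable to the value of $e$ in the current state; a conditional executes $P_1$ if $e$ is true in the current state and $P_2$ otherwise; $P_1;P_2$ executes $P_1$ then $P_2$). FOOL with tuples. FOOL is many-sorted first-order logic in which there is a boolean sort whose terms are identified with formulas, together with expressions $\mathtt{if}\ \varphi\ \mathtt{then}\ s\ \mathtt{else}\ t$ (value of $s$ if $\varphi$ is true, of $t$ otherwise) and $\mathtt{let}\ \ldots\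 \mathtt{in}\ \ldots$ expressions. It is extended with tuple expressions: if $t_i$ has type $\sigma_i$ then $(t_1,\ldots,t_n)$ has type $(\sigma_1,\ldots,\sigma_n)$, and with tuple bindings $\mathtt{let}\ (x_1,\ldots,x_n) = E\ \mathtt{in}\ F$, whose value in a state $s$ is the value of $F$ in the state obtained from $s$ by setting $x_i$ to $w_i$ for each $i$, where $(w_1,\ldots,w_n)$ is the value of $E$ in $s$. The value of a tuple expression $(t_1,\ldots,t_n)$ is the tuple of values of its components. Translation. $[P]$ always has the form $\mathtt{let}\ D\ \mathtt{in}\ (x_1,\ldots,x_n)$ and is defined inductively: - $[x_i := e]$ is $\mathtt{let}\ (x_1,\ldots,x_n) = (x_1,\ldots,x_{i-1},e,x_{i+1},\ldots,x_n)\ \mathtt{in}\ (x_1,\ldots,x_n)$; - $[\textbf{if } e \textbf{ then } P_1 \textbf{ else } P_2]$ is $\mathtt{let}\ (x_1,\ldots,x_n) = (\mathtt{if}\ e\ \mathtt{then}\ [P_1]\ \mathtt{else}\ [P_2])\ \mathtt{in}\ (x_1,\ldots,x_n)$; - $[P_1;P_2]$ is $\mathtt{let}\ D\ \mathtt{in}\ [P_2]$, where $[P_1]$ is $\mathtt{let}\ D\ \mathtt{in}\ (x_1,\ldots,x_n)$. -}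

module Defs where

open import Data.Nat using (ℕ)
open import Data.Fin using (Fin; zero; suc; _≟_)
open import Data.Vec using (Vec; []; _∷_; lookup)
open import Data.List using (List; []; _∷_; _++_; foldr)
open import Data.Bool using (Bool; true; false; if_then_else_)
open import Data.Unit using (⊤; tt)
open import Data.Product using (_×_; _,_; proj₁; proj₂)
open import Relation.Nullary using (yes; no)
open import Relation.Binary.PropositionalEquality using (_≡_; refl)

data Ty (Sort : Set) : Set where
  base  : Sort → Ty Sort
  bool  : Ty Sort
  tuple : {m : ℕ} → Vec (Ty Sort) m → Ty Sort

-- Sym ts τ : function symbols with argument types ts and result type τ
-- (predicate symbols and boolean connectives are symbols with result bool).

record Signature : Set₁ where
  field
    Sort : Set
    Dom  : Sort → Set
    Sym  : {m : ℕ} → Vec (Ty Sort) m → Ty Sort → Set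

  mutual
    ⟦_⟧ : Ty Sort → Set
    ⟦ base s ⟧   = Dom s
    ⟦ bool ⟧     = Bool
    ⟦ tuple ts ⟧ = Vals ts

    Vals : {m : ℕ} → Vec (Ty Sort) m → Set
    Vals []       = ⊤
    Vals (t ∷ ts) = ⟦ t ⟧ × Vals ts

open Signature public

record Interpretation (Σ : Signature) : Set where
  field
    interp : {m : ℕ} {ts : Vec (Ty (Sort Σ)) m} {τ : Ty (Sort Σ)} →
             Sym Σ ts τ → Vals Σ ts → ⟦ Σ ⟧ τ

open Interpretation public

module Language (Σ : Signature) (I : Interpretation Σ) where

  T : Set
  T = Ty (Sort Σ)

  lookupV : {m : ℕ} {ts : Vec T m} → Vals Σ ts → (j : Fin m) → ⟦ Σ ⟧ (lookup ts j)
  lookupV {ts = t ∷ ts} (x , xs) zero    = x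
  lookupV {ts = t ∷ ts} (x , xs) (suc j) = lookupV xs j

  tabV : {m : ℕ} {ts : Vec T m} → ((j : Fin m) → ⟦ Σ ⟧ (lookup ts j)) → Vals Σ ts
  tabV {ts = []}     f = tt
  tabV {ts = t ∷ ts} f = f zero , tabV (λ j → f (suc j))

  State : {n : ℕ} → Vec T n → Set
  State Γ = Vals Σ Γ

  data Exp {n : ℕ} (Γ : Vec T n) : T → Set where
    var : (i : Fin n) → Exp Γ (lookup Γ i)
    app : {m : ℕ} {ts : Vec T m} {τ : T} →
          Sym Σ ts τ → ((j : Fin m) → Exp Γ (lookup ts j)) → Exp Γ τ

  evalE : {n : ℕ} {Γ : Vec T n} {τ : T} → Exp Γ τ → State Γ → ⟦ Σ ⟧ τ
  evalE (var i)    s = lookupV s i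
  evalE (app f as) s = interp I f (tabV (λ j → evalE (as j) s))

  data Prog {n : ℕ} (Γ : Vec T n) : Set where
    assign : (i : Fin n) → Exp Γ (lookup Γ i) → Prog Γ
    ite    : Exp Γ bool → Prog Γ → Prog Γ → Prog Γ
    _⨾_    : Prog Γ → Prog Γ → Prog Γ

  update : {n : ℕ} {Γ : Vec T n} → State Γ → (i : Fin n) → ⟦ Σ ⟧ (lookup Γ i) → State Γ
  update {Γ = t ∷ Γ} (x , xs) zero    w = w , xs
  update {Γ = t ∷ Γ} (x , xs) (suc i) w = x , update xs i w

  data ⟨_,_⟩⇓_ {n : ℕ} {Γ : Vec T n} : Prog Γ → State Γ → State Γ → Set where
    ⇓assign : ∀ {i e s} → ⟨ assign i e , s ⟩⇓ update s i (evalE e s)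
    ⇓ite-t  : ∀ {e P₁ P₂ s s′} → evalE e s ≡ true →
              ⟨ P₁ , s ⟩⇓ s′ → ⟨ ite e P₁ P₂ , s ⟩⇓ s′
    ⇓ite-f  : ∀ {e P₁ P₂ s s′} → evalE e s ≡ false →
              ⟨ P₂ , s ⟩⇓ s′ → ⟨ ite e P₁ P₂ , s ⟩⇓ s′
    ⇓seq    : ∀ {P₁ P₂ s s′ s″} → ⟨ P₁ , s ⟩⇓ s′ → ⟨ P₂ , s′ ⟩⇓ s″ →
              ⟨ P₁ ⨾ P₂ , s ⟩⇓ s″

  -- FOOL expressions with tuples over the variables x₁,…,xₙ.
  -- letT E F is the tuple binding  let (x₁,…,xₙ) = E in F.

  data Tm {n : ℕ} (Γ : Vec T n) : T → Set where
    var   : (i : Fin n) → Tm Γ (lookup Γ i)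
    app   : {m : ℕ} {ts : Vec T m} {τ : T} →
            Sym Σ ts τ → ((j : Fin m) → Tm Γ (lookup ts j)) → Tm Γ τ
    ite   : {τ : T} → Tm Γ bool → Tm Γ τ → Tm Γ τ → Tm Γ τ
    tup   : {m : ℕ} {ts : Vec T m} → ((j : Fin m) → Tm Γ (lookup ts j)) → Tm Γ (tuple ts)
    letT  : {τ : T} → Tm Γ (tuple Γ) → Tm Γ τ → Tm Γ τ

  eval : {n : ℕ} {Γ : Vec T n} {τ : T} → Tm Γ τ → State Γ → ⟦ Σ ⟧ τ
  eval (var i)      s = lookupV s i
  eval (app f as)   s = interp I f (tabV (λ j → eval (as j) s))
  eval (ite c a b)  s = if eval c s then eval a s else eval b s
  eval (tup as)     s = tabV (λ j → eval (as j) s)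
  eval (letT E F)   s = eval F (eval E s)

  ⌜_⌝ : {n : ℕ} {Γ : Vec T n} {τ : T} → Exp Γ τ → Tm Γ τ
  ⌜ var i ⌝    = var i
  ⌜ app f as ⌝ = app f (λ j → ⌜ as j ⌝)

  -- Translation.  [P] = let D in (x₁,…,xₙ), where D is a sequence of
  -- tuple bindings  (x₁,…,xₙ) = Eₖ, read as nested lets.

  xs : {n : ℕ} {Γ : Vec T n} → Tm Γ (tuple Γ)
  xs = tup var

  Binds : {n : ℕ} → Vec T n → Set
  Binds Γ = List (Tm Γ (tuple Γ))

  letD : {n : ℕ} {Γ : Vec T n} {τ : T} → Binds Γ → Tm Γ τ → Tm Γ τ
  letD D F = foldr letT F D

  assignTuple : {n : ℕ} {Γ : Vec T n} (i : Fin n) → Tm Γ (lookup Γ i) → Tm Γ (tuple Γ)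
  assignTuple {Γ = Γ} i e = tup comp
    where
    comp : (j : Fin _) → Tm Γ (lookup Γ j)
    comp j with j ≟ i
    ... | yes refl = e
    ... | no _     = var j

  mutual
    bindsOf : {n : ℕ} {Γ : Vec T n} → Prog Γ → Binds Γ
    bindsOf (assign i e) = assignTuple i ⌜ e ⌝ ∷ []
    bindsOf (ite e P₁ P₂) = ite ⌜ e ⌝ [ P₁ ] [ P₂ ] ∷ []
    bindsOf (P₁ ⨾ P₂)    = bindsOf P₁ ++ bindsOf P₂

    [_] : {n : ℕ} {Γ : Vec T n} → Prog Γ → Tm Γ (tuple Γ)
    [ P ] = letD (bindsOf P) xs

module Submission where

-- A list of tuple bindings  D = E₁ ∷ … ∷ Eₖ  acts on states: `run D` feeds the
-- state through E₁, …, Eₖ in turn.  The proof has three layers.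
--   * Tuple values: lookupV/tabV are mutually inverse, so tuples are
--     determined by their components; this yields that the identity tuple
--     (x₁,…,xₙ) evaluates to the current state and that the assignment tuple
--     (x₁,…,e,…,xₙ) evaluates to the updated state s[xᵢ ↦ e(s)].
--   * Bindings: evaluating  let D in F  is evaluating F after `run D`, and
--     `run` turns concatenation of binding lists into composition; hence
--     the value of [P] is `run (bindsOf P)`.
--   * Soundness: by induction on the big-step derivation ⟨ P , u ⟩⇓ v,
--     `run (bindsOf P) u ≡ v`; assignment and conditional use the first
--     layer, sequential composition is exactly the composition law of `run`.

open import Defs
open import Data.Nat using (ℕ)
open import Data.Vec using (Vec; []; _∷_; lookup)
open import Data.List using ([]; _∷_; _++_)
open import Data.Fin using (Fin; zero; suc; _≟_)
open import Data.Bool using (if_then_else_)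
open import Data.Unit using (tt)
open import Data.Product using (_,_)
open import Relation.Nullary using (yes; no; ¬_)
open import Relation.Binary.PropositionalEquality
  using (_≡_; refl; sym; trans; cong; cong₂; module ≡-Reasoning)

module Soundness (Σ : Signature) (I : Interpretation Σ) where
  open Language Σ I
  open ≡-Reasoning

  lookup-tabV : {m : ℕ} {ts : Vec T m} (f : (j : Fin m) → ⟦ Σ ⟧ (lookup ts j)) (j : Fin m) →
                lookupV {ts = ts} (tabV f) j ≡ f j
  lookup-tabV {ts = t ∷ ts} f zero    = refl
  lookup-tabV {ts = t ∷ ts} f (suc j) = lookup-tabV {ts = ts} (λ k → f (suc k)) j

  tabV-lookupV : {m : ℕ} {ts : Vec T m} (w : Vals Σ ts) → tabV (lookupV w) ≡ w
  tabV-lookupV {ts = []}     tt      = refl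
  tabV-lookupV {ts = t ∷ ts} (x , w) = cong (x ,_) (tabV-lookupV w)

  tuple-ext : {m : ℕ} {ts : Vec T m} (a b : Vals Σ ts) →
              (∀ j → lookupV a j ≡ lookupV b j) → a ≡ b
  tuple-ext {ts = []}     tt      tt      _  = refl
  tuple-ext {ts = t ∷ ts} (x , a) (y , b) eq =
    cong₂ _,_ (eq zero) (tuple-ext a b (λ j → eq (suc j)))

  tabV-cong : {m : ℕ} {ts : Vec T m} {f g : (j : Fin m) → ⟦ Σ ⟧ (lookup ts j)} →
              (∀ j → f j ≡ g j) → tabV {ts = ts} f ≡ tabV g
  tabV-cong {ts = []}     eq = refl
  tabV-cong {ts = t ∷ ts} eq = cong₂ _,_ (eq zero) (tabV-cong {ts = ts} (λ j → eq (suc j)))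

  lookup-update-same : {n : ℕ} {Γ : Vec T n} (s : State Γ) (i : Fin n) (w : ⟦ Σ ⟧ (lookup Γ i)) →
                       lookupV (update s i w) i ≡ w
  lookup-update-same {Γ = t ∷ Γ} (x , s) zero    w = refl
  lookup-update-same {Γ = t ∷ Γ} (x , s) (suc i) w = lookup-update-same s i w

  lookup-update-other : {n : ℕ} {Γ : Vec T n} (s : State Γ) (i j : Fin n) (w : ⟦ Σ ⟧ (lookup Γ i)) →
                        ¬ j ≡ i → lookupV (update s i w) j ≡ lookupV s j
  lookup-update-other {Γ = t ∷ Γ} (x , s) zero    zero    w j≢i with () ← j≢i refl
  lookup-update-other {Γ = t ∷ Γ} (x , s) zero    (suc j) w j≢i = refl
  lookup-update-other {Γ = t ∷ Γ} (x , s) (suc i) zero    w j≢i = refl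
  lookup-update-other {Γ = t ∷ Γ} (x , s) (suc i) (suc j) w j≢i =
    lookup-update-other s i j w (λ j≡i → j≢i (cong suc j≡i))

  eval-embed : {n : ℕ} {Γ : Vec T n} {τ : T} (e : Exp Γ τ) (s : State Γ) →
               eval ⌜ e ⌝ s ≡ evalE e s
  eval-embed (var i)              s = refl
  eval-embed (app {ts = ts} f as) s =
    cong (interp I f) (tabV-cong {ts = ts} (λ j → eval-embed (as j) s))

  eval-xs : {n : ℕ} {Γ : Vec T n} (s : State Γ) → eval xs s ≡ s
  eval-xs = tabV-lookupV

  -- View exposing that a term is syntactically a tuple (t₁,…,tₘ); needed
  -- because the components of the assignment tuple are defined locally.
  data IsTuple {n m : ℕ} {Γ : Vec T n} {ts : Vec T m} : Tm Γ (tuple ts) → Set where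
    tuple-of : (as : (j : Fin m) → Tm Γ (lookup ts j)) → IsTuple (tup as)

  entry : {n m : ℕ} {Γ : Vec T n} {ts : Vec T m} {t : Tm Γ (tuple ts)} →
          IsTuple t → (j : Fin m) → Tm Γ (lookup ts j)
  entry (tuple-of as) j = as j

  lookup-eval-tuple : {n m : ℕ} {Γ : Vec T n} {ts : Vec T m} {t : Tm Γ (tuple ts)}
                      (p : IsTuple t) (s : State Γ) (j : Fin m) →
                      lookupV (eval t s) j ≡ eval (entry p j) s
  lookup-eval-tuple {ts = ts} (tuple-of as) s j = lookup-tabV {ts = ts} (λ k → eval (as k) s) j

  assignTuple-isTuple : {n : ℕ} {Γ : Vec T n} (i : Fin n) (e : Tm Γ (lookup Γ i)) →
                        IsTuple (assignTuple i e)
  assignTuple-isTuple i e = tuple-of _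

  eval-assignTuple-entry : {n : ℕ} {Γ : Vec T n} (i j : Fin n) (e : Tm Γ (lookup Γ i)) (s : State Γ) →
                           eval (entry (assignTuple-isTuple i e) j) s ≡ lookupV (update s i (eval e s)) j
  eval-assignTuple-entry i j e s with j ≟ i
  ... | yes refl = sym (lookup-update-same s j (eval e s))
  ... | no j≢i   = sym (lookup-update-other s i j (eval e s) j≢i)

  eval-assignTuple : {n : ℕ} {Γ : Vec T n} (i : Fin n) (e : Tm Γ (lookup Γ i)) (s : State Γ) →
                     eval (assignTuple i e) s ≡ update s i (eval e s)
  eval-assignTuple i e s = tuple-ext _ _ λ j →
    trans (lookup-eval-tuple (assignTuple-isTuple i e) s j) (eval-assignTuple-entry i j e s)

  run : {n : ℕ} {Γ : Vec T n} → Binds Γ → State Γ → State Γ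
  run []      s = s
  run (E ∷ D) s = run D (eval E s)

  eval-letD : {n : ℕ} {Γ : Vec T n} {τ : T} (D : Binds Γ) (F : Tm Γ τ) (s : State Γ) →
              eval (letD D F) s ≡ eval F (run D s)
  eval-letD []      F s = refl
  eval-letD (E ∷ D) F s = eval-letD D F (eval E s)

  run-++ : {n : ℕ} {Γ : Vec T n} (D₁ D₂ : Binds Γ) (s : State Γ) →
           run (D₁ ++ D₂) s ≡ run D₂ (run D₁ s)
  run-++ []       D₂ s = refl
  run-++ (E ∷ D₁) D₂ s = run-++ D₁ D₂ (eval E s)

  eval-translation : {n : ℕ} {Γ : Vec T n} (P : Prog Γ) (s : State Γ) →
                     eval [ P ] s ≡ run (bindsOf P) s
  eval-translation P s = trans (eval-letD (bindsOf P) xs s) (eval-xs (run (bindsOf P) s))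

  run-sound : {n : ℕ} {Γ : Vec T n} {P : Prog Γ} {u v : State Γ} →
              ⟨ P , u ⟩⇓ v → run (bindsOf P) u ≡ v
  run-sound {u = u} (⇓assign {i} {e}) = begin
    eval (assignTuple i ⌜ e ⌝) u   ≡⟨ eval-assignTuple i ⌜ e ⌝ u ⟩
    update u i (eval ⌜ e ⌝ u)       ≡⟨ cong (update u i) (eval-embed e u) ⟩
    update u i (evalE e u)          ∎
  run-sound {u = u} {v} (⇓ite-t {e} {P₁} {P₂} e-true d) = begin
    (if eval ⌜ e ⌝ u then eval [ P₁ ] u else eval [ P₂ ] u)
      ≡⟨ cong (λ b → if b then eval [ P₁ ] u else eval [ P₂ ] u) (trans (eval-embed e u) e-true) ⟩
    eval [ P₁ ] u          ≡⟨ eval-translation P₁ u ⟩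
    run (bindsOf P₁) u     ≡⟨ run-sound d ⟩
    v                      ∎
  run-sound {u = u} {v} (⇓ite-f {e} {P₁} {P₂} e-false d) = begin
    (if eval ⌜ e ⌝ u then eval [ P₁ ] u else eval [ P₂ ] u)
      ≡⟨ cong (λ b → if b then eval [ P₁ ] u else eval [ P₂ ] u) (trans (eval-embed e u) e-false) ⟩
    eval [ P₂ ] u          ≡⟨ eval-translation P₂ u ⟩
    run (bindsOf P₂) u     ≡⟨ run-sound d ⟩
    v                      ∎
  run-sound {u = u} {v} (⇓seq {P₁} {P₂} {s′ = w} d₁ d₂) = begin
    run (bindsOf P₁ ++ bindsOf P₂) u      ≡⟨ run-++ (bindsOf P₁) (bindsOf P₂) u ⟩
    run (bindsOf P₂) (run (bindsOf P₁) u) ≡⟨ cong (run (bindsOf P₂)) (run-sound d₁) ⟩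
    run (bindsOf P₂) w                    ≡⟨ run-sound d₂ ⟩
    v                                     ∎

theorem1 : (Σ : Signature) (I : Interpretation Σ) {n : ℕ} (Γ : Vec (Ty (Sort Σ)) n)
           (P : Language.Prog Σ I Γ) (u v : Language.State Σ I Γ) →
           Language.⟨_,_⟩⇓_ Σ I P u v →
           Language.eval Σ I (Language.[_] Σ I P) u ≡ v
theorem1 Σ I Γ P u v d = trans (eval-translation P u) (run-sound d)
  where open Soundness Σ I
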